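{- Let $a,b$ be relatively prime integers with $2\le a<b$. Then the number of exceptional values with respect to $a$ and $b$ is exactly $\frac{(a-3)(b-1)}{2}+\left\lfloor \frac{b}{a}\right\rfloor$.
   Context: For relatively prime positive integers $a_1,\dots,a_n$ (each at least 2), the Frobenius number $g(a_1,\dots,a_n)$ is the largest integer not representable as a nonnegative integer linear combination of $a_1,\dots,a_n$. Given relatively prime $a<b$, an integer $c>b$ (with $a,b,c$ relatively prime) is called an exceptional value with respect to $a$ and $b$ if $g(a,b,c)<g(a,b)$. -}

module Defs where

open import Data.Nat using (ℕ; _+_; _*_; _<_)
open import Data.Nat.GCD using (gcd)
open import Data.Product using (∃; ∃-syntax; _×_)
open import Relation.Binary.PropositionalEquality using (_≡_)
open import Relation.Nullary using (¬_)

Rep₂ : ℕ → ℕ → ℕ → Set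
Rep₂ a b n = ∃[ x ] ∃[ y ] x * a + y * b ≡ n

Rep₃ : ℕ → ℕ → ℕ → ℕ → Set
Rep₃ a b c n = ∃[ x ] ∃[ y ] ∃[ z ] x * a + y * b + z * c ≡ n

-- g is the Frobenius number g(a,b): the largest integer not representable.
-- (Negative integers are never representable, and with all generators ≥ 2
--  the integer 1 is not representable, so the Frobenius number is a
--  positive natural number; quantifying over ℕ loses nothing.)
IsFrobenius₂ : ℕ → ℕ → ℕ → Set
IsFrobenius₂ a b g = ¬ Rep₂ a b g × (∀ m → g < m → Rep₂ a b m)

IsFrobenius₃ : ℕ → ℕ → ℕ → ℕ → Set
IsFrobenius₃ a b c g = ¬ Rep₃ a b c g × (∀ m → g < m → Rep₃ a b c m)

Exceptional : ℕ → ℕ → ℕ → Set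
Exceptional a b c =
  b < c × gcd (gcd a b) c ≡ 1 ×
  ∃[ g₃ ] ∃[ g₂ ] IsFrobenius₃ a b c g₃ × IsFrobenius₂ a b g₂ × g₃ < g₂

-- Write a gap of ⟨a, b⟩ in Sylvester's form c = y·b − (k+1)·a with y < a.  Then
-- g(a, b) − c = (a−1−y)·b + k·a, so every gap c > b lowers the Frobenius number once
-- it is added as a generator; conversely a representable c changes nothing.  Hence
-- the exceptional values are exactly the gaps above b, namely (j+1)·b − (k+1)·a with
-- 1 ≤ j ≤ a−2 and k + 1 ≤ ⌊jb/a⌋.  Pairing ⌊jb/a⌋ + ⌊(a−j)b/a⌋ = b − 1 sums these
-- counts to (a−3)(b−1)/2 + ⌊b/a⌋.
module Submission where

open import Data.Empty using (⊥-elim)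
open import Data.Integer as ℤ using (ℤ; +_; -[1+_]; _/ℕ_)
open import Data.Integer.Properties using (pos-*)
import Data.Integer.Tactic.RingSolver as ℤ-Ring
open import Data.List using (List; []; _∷_; _++_; length; applyUpTo)
open import Data.List.Properties using (length-++; length-applyUpTo)
open import Data.List.Membership.Propositional using (_∈_)
open import Data.List.Membership.Propositional.Properties
  using (∈-++⁺ˡ; ∈-++⁺ʳ; ∈-++⁻; ∈-applyUpTo⁺; ∈-applyUpTo⁻)
open import Data.List.Relation.Binary.Disjoint.Propositional using (Disjoint)
open import Data.List.Relation.Unary.AllPairs using ([])
open import Data.List.Relation.Unary.Unique.Propositional using (Unique)
open import Data.List.Relation.Unary.Unique.Propositional.Properties using (++⁺; applyUpTo⁺₁)
open import Data.Nat
open import Data.Nat.Coprimality using (Coprime; coprime-Bézout; coprime-divisor; coprime⇒gcd≡1)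
open import Data.Nat.DivMod
open import Data.Nat.Divisibility using (_∣_; divides; ∣⇒≤; m%n≡0⇒n∣m)
open import Data.Nat.GCD using (gcd; gcd-zeroˡ; module Bézout)
open import Data.Nat.Properties
open import Algebra.Properties.CommutativeSemigroup +-commutativeSemigroup
  using (interchange; xy∙z≈xz∙y)
import Data.Nat.Tactic.RingSolver as ℕ-Ring
open import Data.Product using (∃-syntax; _×_; _,_)
open import Data.Sum using (_⊎_; inj₁; inj₂)
open import Function using (_∘′_)
open import Function.Bundles using (_⇔_; mk⇔)
open import Relation.Binary.PropositionalEquality
open import Relation.Nullary using (¬_; yes; no; contradiction)
open import Relation.Nullary.Decidable using (map′; _×-dec_)
open import Relation.Unary using (Decidable)

open import Defs

∑ : (ℕ → ℕ) → ℕ → ℕ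
∑ g zero    = 0
∑ g (suc m) = ∑ g m + g (suc m)

∑-cong : ∀ {g h} m → (∀ {j} → 0 < j → j ≤ m → g j ≡ h j) → ∑ g m ≡ ∑ h m
∑-cong zero    _   = refl
∑-cong (suc m) g≗h =
  cong₂ _+_ (∑-cong m λ 0<j j≤m → g≗h 0<j (m≤n⇒m≤1+n j≤m)) (g≗h z<s ≤-refl)

∑-distrib-+ : ∀ g h m → ∑ (λ j → g j + h j) m ≡ ∑ g m + ∑ h m
∑-distrib-+ g h zero    = refl
∑-distrib-+ g h (suc m) = trans (cong (_+ (g (suc m) + h (suc m))) (∑-distrib-+ g h m))
                               (interchange (∑ g m) (∑ h m) (g (suc m)) (h (suc m)))

∑-const : ∀ c m → ∑ (λ _ → c) m ≡ m * c
∑-const c zero    = refl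
∑-const c (suc m) = trans (cong (_+ c) (∑-const c m)) (+-comm (m * c) c)

∑-shift : ∀ g m → ∑ g (suc m) ≡ ∑ (λ j → g (suc j)) m + g 1
∑-shift g zero    = refl
∑-shift g (suc m) = trans (cong (_+ g (2 + m)) (∑-shift g m))
                          (xy∙z≈xz∙y (∑ (λ j → g (suc j)) m) (g 1) (g (2 + m)))

∑-reverse : ∀ g m → ∑ (λ j → g (suc m ∸ j)) m ≡ ∑ g m
∑-reverse g zero    = refl
∑-reverse g (suc m) = begin
  ∑ (λ j → g (2 + m ∸ j)) m + g (2 + m ∸ suc m)
    ≡⟨ cong₂ _+_ (∑-cong m λ _ j≤m → cong g (+-∸-assoc 1 (m≤n⇒m≤1+n j≤m)))
                 (cong g (m+n∸n≡m 1 (suc m))) ⟩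
  ∑ (λ j → g (suc (suc m ∸ j))) m + g 1   ≡⟨ cong (_+ g 1) (∑-reverse (λ j → g (suc j)) m) ⟩
  ∑ (λ j → g (suc j)) m + g 1             ≡⟨ ∑-shift g m ⟨
  ∑ g (suc m)                             ∎
  where open ≡-Reasoning

∑-pairs : ∀ g m {c} → (∀ {j} → 0 < j → j ≤ m → g j + g (suc m ∸ j) ≡ c) →
          ∑ g m + ∑ g m ≡ m * c
∑-pairs g m {c} pair = begin
  ∑ g m + ∑ g m                       ≡⟨ cong (_+_ (∑ g m)) (∑-reverse g m) ⟨
  ∑ g m + ∑ (λ j → g (suc m ∸ j)) m   ≡⟨ ∑-distrib-+ g (λ j → g (suc m ∸ j)) m ⟨
  ∑ (λ j → g j + g (suc m ∸ j)) m     ≡⟨ ∑-cong m pair ⟩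
  ∑ (λ _ → c) m                       ≡⟨ ∑-const c m ⟩
  m * c                               ∎
  where open ≡-Reasoning

-- The remainders of x and y add up to exactly one a: positive, and less than 2a.
/-complement : ∀ {x y t a} .{{_ : NonZero a}} → ¬ a ∣ x → x + y ≡ t * a →
               suc (x / a + y / a) ≡ t
/-complement {x} {y} {t} {a} a∤x x+y≡ta =
  ≤-antisym (*-cancelʳ-< a s t (subst (s * a <_) division lower))
            (s≤s⁻¹ (*-cancelʳ-< a t (2 + s) (subst (_< (2 + s) * a) division upper)))
  where
    r r′ s : ℕ
    r = x % a
    r′ = y % a
    s = x / a + y / a
    regroup : ∀ r r′ q q′ a → r + r′ + (q + q′) * a ≡ (r + q * a) + (r′ + q′ * a)
    regroup = ℕ-Ring.solve-∀
    division : r + r′ + s * a ≡ t * a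
    division = begin
      r + r′ + s * a                      ≡⟨ regroup r r′ (x / a) (y / a) a ⟩
      (r + x / a * a) + (r′ + y / a * a)  ≡⟨ cong₂ _+_ (m≡m%n+[m/n]*n x a) (m≡m%n+[m/n]*n y a) ⟨
      x + y                               ≡⟨ x+y≡ta ⟩
      t * a                               ∎
      where open ≡-Reasoning
    lower : s * a < r + r′ + s * a
    lower = m<n+m (s * a) (≤-trans (n≢0⇒n>0 (a∤x ∘′ m%n≡0⇒n∣m x a)) (m≤m+n r r′))
    upper : r + r′ + s * a < (2 + s) * a
    upper = begin-strict
      r + r′ + s * a      <⟨ +-monoˡ-< (s * a) (+-mono-< (m%n<n x a) (m%n<n y a)) ⟩
      (a + a) + s * a     ≡⟨ +-assoc a a (s * a) ⟩
      (2 + s) * a         ∎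
      where open ≤-Reasoning

i*n/ℕn≡i : ∀ (i : ℤ) n .{{_ : NonZero n}} → (i ℤ.* + n) /ℕ n ≡ i
i*n/ℕn≡i (+ m)     n         = trans (cong (_/ℕ n) (sym (pos-* m n))) (cong +_ (m*n/n≡m m n))
i*n/ℕn≡i -[1+ m ] n@(suc n′) with suc m * n % n in eq
... | zero  = cong (ℤ.-_ ∘′ +_) (m*n/n≡m (suc m) n)
... | suc _ = contradiction (trans (sym eq) (m*n%n≡0 (suc m) n)) λ ()

closed-form : ∀ (N B S F Q : ℤ) → (S ℤ.+ F) ℤ.+ (S ℤ.+ F) ≡ (+ 1 ℤ.+ N) ℤ.* B → Q ℤ.+ F ≡ B →
              S ≡ ((+ 2 ℤ.+ N ℤ.- + 3) ℤ.* (+ 1 ℤ.+ B ℤ.- + 1)) /ℕ 2 ℤ.+ Q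
closed-form N B S F Q 2[S+F]≡[1+N]B Q+F≡B = sym (begin
  ((+ 2 ℤ.+ N ℤ.- + 3) ℤ.* (+ 1 ℤ.+ B ℤ.- + 1)) /ℕ 2 ℤ.+ Q ≡⟨ cong (λ i → i /ℕ 2 ℤ.+ Q) doubled ⟩
  ((S ℤ.- Q) ℤ.* + 2) /ℕ 2 ℤ.+ Q                          ≡⟨ cong (ℤ._+ Q) (i*n/ℕn≡i (S ℤ.- Q) 2) ⟩
  S ℤ.- Q ℤ.+ Q                                           ≡⟨ ℤ-Ring.solve (S ∷ Q ∷ []) ⟩
  S                                                       ∎)
  where
    open ≡-Reasoning
    doubled : (+ 2 ℤ.+ N ℤ.- + 3) ℤ.* (+ 1 ℤ.+ B ℤ.- + 1) ≡ (S ℤ.- Q) ℤ.* + 2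
    doubled = begin
      (+ 2 ℤ.+ N ℤ.- + 3) ℤ.* (+ 1 ℤ.+ B ℤ.- + 1)         ≡⟨ ℤ-Ring.solve (N ∷ B ∷ []) ⟩
      (+ 1 ℤ.+ N) ℤ.* B ℤ.- B ℤ.- B
        ≡⟨ cong (λ i → i ℤ.- B ℤ.- B) 2[S+F]≡[1+N]B ⟨
      (S ℤ.+ F) ℤ.+ (S ℤ.+ F) ℤ.- B ℤ.- B
        ≡⟨ cong (λ i → (S ℤ.+ F) ℤ.+ (S ℤ.+ F) ℤ.- i ℤ.- i) Q+F≡B ⟨
      (S ℤ.+ F) ℤ.+ (S ℤ.+ F) ℤ.- (Q ℤ.+ F) ℤ.- (Q ℤ.+ F) ≡⟨ ℤ-Ring.solve (S ∷ F ∷ Q ∷ []) ⟩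
      (S ℤ.- Q) ℤ.* + 2                                    ∎

rows : ∀ {A : Set} → (ℕ → List A) → ℕ → List A
rows r zero    = []
rows r (suc m) = rows r m ++ r (suc m)

∈-rows⁻ : ∀ {A : Set} {x : A} r m → x ∈ rows r m → ∃[ j ] 0 < j × j ≤ m × x ∈ r j
∈-rows⁻ r (suc m) x∈ with ∈-++⁻ (rows r m) x∈
... | inj₁ x∈rows = let j , 0<j , j≤m , x∈rj = ∈-rows⁻ r m x∈rows
                    in j , 0<j , m≤n⇒m≤1+n j≤m , x∈rj
... | inj₂ x∈r    = suc m , z<s , ≤-refl , x∈r

∈-rows⁺ : ∀ {A : Set} {x : A} r {j m} → 0 < j → j ≤ m → x ∈ r j → x ∈ rows r m
∈-rows⁺ r {m = zero}  z<s ()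
∈-rows⁺ r {m = suc m} 0<j j≤1+m x∈rj with m≤n⇒m<n∨m≡n j≤1+m
... | inj₁ j<1+m = ∈-++⁺ˡ (∈-rows⁺ r 0<j (s≤s⁻¹ j<1+m) x∈rj)
... | inj₂ refl  = ∈-++⁺ʳ (rows r m) x∈rj

length-rows : ∀ {A : Set} (r : ℕ → List A) m → length (rows r m) ≡ ∑ (λ j → length (r j)) m
length-rows r zero    = refl
length-rows r (suc m) =
  trans (length-++ (rows r m)) (cong (_+ length (r (suc m))) (length-rows r m))

rows-unique : ∀ {A : Set} (r : ℕ → List A) m →
              (∀ {j} → 0 < j → j ≤ m → Unique (r j)) →
              (∀ {i j} → 0 < i → i < j → j ≤ m → Disjoint (r i) (r j)) →
              Unique (rows r m)
rows-unique r zero    _      _        = []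
rows-unique r (suc m) unique disjoint = ++⁺
  (rows-unique r m (λ 0<j j≤m → unique 0<j (m≤n⇒m≤1+n j≤m))
                   (λ 0<i i<j j≤m → disjoint 0<i i<j (m≤n⇒m≤1+n j≤m)))
  (unique z<s ≤-refl)
  (λ (x∈rows , x∈r) → let i , 0<i , i≤m , x∈ri = ∈-rows⁻ r m x∈rows in
                       disjoint 0<i (s≤s i≤m) ≤-refl (x∈ri , x∈r))

largest-failure : ∀ {P : ℕ → Set} → Decidable P → ∀ {n₀} N → ¬ P n₀ → n₀ ≤ N →
                  (∀ m → N < m → P m) → ∃[ g ] g ≤ N × ¬ P g × (∀ m → g < m → P m)
largest-failure P? N ¬Pn₀ n₀≤N above with P? N
largest-failure P? N       ¬Pn₀ n₀≤N   above | no ¬PN = N , ≤-refl , ¬PN , above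
largest-failure P? zero    ¬Pn₀ z≤n    above | yes P0 = contradiction P0 ¬Pn₀
largest-failure {P} P? {n₀} (suc N) ¬Pn₀ n₀≤1+N above | yes P[1+N] =
  let g , g≤N , ¬Pg , above-g = largest-failure P? N ¬Pn₀ n₀≤N above′ in
  g , m≤n⇒m≤1+n g≤N , ¬Pg , above-g
  where
    n₀≤N : n₀ ≤ N
    n₀≤N = s≤s⁻¹ (≤∧≢⇒< n₀≤1+N λ n₀≡1+N → ¬Pn₀ (subst P (sym n₀≡1+N) P[1+N]))
    above′ : ∀ m → N < m → P m
    above′ m N<m with m≤n⇒m<n∨m≡n N<m
    ... | inj₁ 1+N<m = above m 1+N<m
    ... | inj₂ refl  = P[1+N]

-- 1 + y·b = x·a is turned into an identity of the other sign by multiplying with a − 1 ≡ −1.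
coprime⇒invertible : ∀ {a b} → 1 < a → Coprime a b → ∃[ w ] ∃[ K ] w * b ≡ 1 + K * a
coprime⇒invertible {b = b} (s≤s (s≤s {n = n} z≤n)) a⊥b with coprime-Bézout a⊥b
... | Bézout.-+ K w 1+Ka≡wb = w , K , sym 1+Ka≡wb
... | Bézout.+- zero    _ ()
... | Bézout.+- (suc x) y 1+yb≡xa = y * suc n , x + n * suc x , +-cancelˡ-≡ (suc n) _ _ (begin
  suc n + y * suc n * b                   ≡⟨ ℕ-Ring.solve (n ∷ y ∷ b ∷ []) ⟩
  suc n * (1 + y * b)                     ≡⟨ cong (suc n *_) 1+yb≡xa ⟩
  suc n * (suc x * (2 + n))               ≡⟨ ℕ-Ring.solve (n ∷ x ∷ []) ⟩
  suc n + (1 + (x + n * suc x) * (2 + n)) ∎)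
  where open ≡-Reasoning

rep₂⇒rep₃ : ∀ {a b c m} → Rep₂ a b m → Rep₃ a b c m
rep₂⇒rep₃ (x , y , xa+yb≡m) = x , y , 0 , trans (+-identityʳ _) xa+yb≡m

rep₃⇒rep₂ : ∀ {a b c m} → Rep₂ a b c → Rep₃ a b c m → Rep₂ a b m
rep₃⇒rep₂ {a} {b} {c} {m} (x₀ , y₀ , x₀a+y₀b≡c) (x , y , z , xa+yb+zc≡m) =
  x + z * x₀ , y + z * y₀ , (begin
    (x + z * x₀) * a + (y + z * y₀) * b   ≡⟨ ℕ-Ring.solve (x ∷ z ∷ x₀ ∷ a ∷ y ∷ y₀ ∷ b ∷ []) ⟩
    x * a + y * b + z * (x₀ * a + y₀ * b) ≡⟨ cong (λ c′ → x * a + y * b + z * c′) x₀a+y₀b≡c ⟩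
    x * a + y * b + z * c                 ≡⟨ xa+yb+zc≡m ⟩
    m                                     ∎)
  where open ≡-Reasoning

¬rep₃-1 : ∀ {a b c} → 1 < a → 1 < b → 1 < c → ¬ Rep₃ a b c 1
¬rep₃-1 {a} {b} {c} 1<a 1<b 1<c (x , y , z , eq) =
  0≢1+n (trans (sym xa+yb+zc≡0) eq)
  where
    vanishes : ∀ k {n} → 1 < n → k * n ≤ 1 → k * n ≡ 0
    vanishes zero        _   _  = refl
    vanishes (suc k) {n} 1<n le = contradiction (≤-trans (m≤m+n n (k * n)) le) (<⇒≱ 1<n)
    xa≤1 : x * a ≤ 1
    xa≤1 = ≤-trans (≤-trans (m≤m+n (x * a) (y * b)) (m≤m+n _ (z * c))) (≤-reflexive eq)
    yb≤1 : y * b ≤ 1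
    yb≤1 = ≤-trans (≤-trans (m≤n+m (y * b) (x * a)) (m≤m+n _ (z * c))) (≤-reflexive eq)
    zc≤1 : z * c ≤ 1
    zc≤1 = ≤-trans (m≤n+m (z * c) (x * a + y * b)) (≤-reflexive eq)
    xa+yb+zc≡0 : x * a + y * b + z * c ≡ 0
    xa+yb+zc≡0 =
      cong₂ _+_ (cong₂ _+_ (vanishes x 1<a xa≤1) (vanishes y 1<b yb≤1)) (vanishes z 1<c zc≤1)

rep₃? : ∀ {a b c} → 0 < c → Decidable (Rep₂ a b) → Decidable (Rep₃ a b c)
rep₃? {a} {b} {c} 0<c rep₂? m =
  map′ from to (anyUpTo? (λ z → (z * c ≤? m) ×-dec rep₂? (m ∸ z * c)) (suc m))
  where
    from : ∃[ z ] z < suc m × z * c ≤ m × Rep₂ a b (m ∸ z * c) → Rep₃ a b c m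
    from (z , _ , zc≤m , x , y , eq) = x , y , z , trans (cong (_+ z * c) eq) (m∸n+n≡m zc≤m)
    to : Rep₃ a b c m → ∃[ z ] z < suc m × z * c ≤ m × Rep₂ a b (m ∸ z * c)
    to (x , y , z , eq) =
      z , s≤s (≤-trans (m≤m*n z c {{>-nonZero 0<c}}) zc≤m) , zc≤m ,
      x , y , trans (sym (m+n∸n≡m _ (z * c))) (cong (_∸ z * c) eq)
      where
        zc≤m : z * c ≤ m
        zc≤m = ≤-trans (m≤n+m (z * c) (x * a + y * b)) (≤-reflexive eq)

exceptional⇒¬rep₂ : ∀ {a b c} → Exceptional a b c → b < c × ¬ Rep₂ a b c
exceptional⇒¬rep₂ (b<c , _ , g₃ , g₂ , (_ , above₃) , (¬rep₂-g₂ , _) , g₃<g₂) =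
  b<c , λ rep₂-c → ¬rep₂-g₂ (rep₃⇒rep₂ rep₂-c (above₃ g₂ g₃<g₂))

module TwoGenerators (a b : ℕ) .{{_ : NonZero a}} .{{_ : NonZero b}}
                     (a⊥b : Coprime a b) (1<a : 1 < a) where

  a∤j*b : ∀ {j} → 0 < j → j < a → ¬ a ∣ j * b
  a∤j*b {suc j} _ j<a a∣jb =
    <⇒≱ j<a (∣⇒≤ (coprime-divisor a⊥b (subst (a ∣_) (*-comm (suc j) b) a∣jb)))

  j*b≡k*a⇒k≡0 : ∀ {j k} → j < a → j * b ≡ k * a → k ≡ 0
  j*b≡k*a⇒k≡0 {zero}  {k} _   0≡ka  = m*n≡0⇒m≡0 k a (sym 0≡ka)
  j*b≡k*a⇒k≡0 {suc j} {k} j<a jb≡ka = contradiction (divides k jb≡ka) (a∤j*b z<s j<a)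

  y*b≡y′*b+k*a⇒k≡0 : ∀ {y y′ k} → y < a → y * b ≡ y′ * b + k * a → k ≡ 0
  y*b≡y′*b+k*a⇒k≡0 {y} {y′} {k} y<a eq with ≤-total y y′
  ... | inj₁ y≤y′ with (d , refl) ← m≤n⇒∃[o]m+o≡n y≤y′ =
    m*n≡0⇒m≡0 k a (m+n≡0⇒n≡0 (d * b) (+-cancelˡ-≡ (y * b) _ _ (begin
      y * b + (d * b + k * a) ≡⟨ ℕ-Ring.solve (y ∷ d ∷ b ∷ k ∷ a ∷ []) ⟩
      (y + d) * b + k * a     ≡⟨ eq ⟨
      y * b                   ≡⟨ +-identityʳ (y * b) ⟨
      y * b + 0               ∎)))
    where open ≡-Reasoning
  ... | inj₂ y′≤y with (d , refl) ← m≤n⇒∃[o]m+o≡n y′≤y =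
    j*b≡k*a⇒k≡0 (≤-<-trans (m≤n+m d y′) y<a)
                (+-cancelˡ-≡ (y′ * b) _ _ (trans (sym (*-distribʳ-+ b y′ d)) eq))

  Gap : ℕ → Set
  Gap m = ∃[ y ] ∃[ k ] y < a × m + suc k * a ≡ y * b

  gap⇒¬rep₂ : ∀ {m} → Gap m → ¬ Rep₂ a b m
  gap⇒¬rep₂ {m} (y , k , y<a , m+ka≡yb) (x , y′ , xa+y′b≡m) =
    0≢1+n {x + k} (sym (y*b≡y′*b+k*a⇒k≡0 {y′ = y′} y<a (begin
      y * b                      ≡⟨ m+ka≡yb ⟨
      m + suc k * a              ≡⟨ cong (_+ suc k * a) xa+y′b≡m ⟨
      x * a + y′ * b + suc k * a ≡⟨ ℕ-Ring.solve (x ∷ a ∷ y′ ∷ b ∷ k ∷ []) ⟩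
      y′ * b + suc (x + k) * a   ∎)))
    where open ≡-Reasoning

  gap-index-≤ : ∀ {m y y′ k k′} → y′ < a → m + suc k * a ≡ y * b → m + suc k′ * a ≡ y′ * b →
                k ≤ k′ → y′ ≡ y
  gap-index-≤ {m} {y} {y′} {k} y′<a eq eq′ k≤k′ with (e , refl) ← m≤n⇒∃[o]m+o≡n k≤k′ =
    *-cancelʳ-≡ y′ y b
      (trans shifted (trans (cong (λ e′ → y * b + e′ * a) e≡0) (+-identityʳ (y * b))))
    where
      open ≡-Reasoning
      shifted : y′ * b ≡ y * b + e * a
      shifted = begin
        y′ * b                ≡⟨ eq′ ⟨
        m + suc (k + e) * a   ≡⟨ ℕ-Ring.solve (m ∷ k ∷ e ∷ a ∷ []) ⟩
        m + suc k * a + e * a ≡⟨ cong (_+ e * a) eq ⟩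
        y * b + e * a         ∎
      e≡0 : e ≡ 0
      e≡0 = y*b≡y′*b+k*a⇒k≡0 {y′ = y} y′<a shifted

  gap-index-unique : ∀ {m y y′ k k′} → y < a → y′ < a →
                     m + suc k * a ≡ y * b → m + suc k′ * a ≡ y′ * b → y ≡ y′
  gap-index-unique {m} {k = k} {k′} y<a y′<a eq eq′ with ≤-total k k′
  ... | inj₁ k≤k′ = sym (gap-index-≤ {m} y′<a eq eq′ k≤k′)
  ... | inj₂ k′≤k = gap-index-≤ {m} y<a eq′ eq k′≤k

  -- The hypothesis says y·b ≡ m (mod a), written without subtraction.
  congruent⇒rep⊎gap : ∀ {m y u v} → y < a → y * b + u * a ≡ m + v * a → Rep₂ a b m ⊎ Gap m
  congruent⇒rep⊎gap {m} {y} {u} {v} y<a eq with ≤-total u v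
  ... | inj₂ v≤u with (t , refl) ← m≤n⇒∃[o]m+o≡n v≤u =
    inj₁ (t , y , +-cancelʳ-≡ (v * a) _ _ (begin
      t * a + y * b + v * a ≡⟨ ℕ-Ring.solve (t ∷ a ∷ y ∷ b ∷ v ∷ []) ⟩
      y * b + (v + t) * a   ≡⟨ eq ⟩
      m + v * a             ∎))
    where open ≡-Reasoning
  ... | inj₁ u≤v with m≤n⇒∃[o]m+o≡n u≤v
  ...   | zero  , refl =
    inj₁ (0 , y , +-cancelʳ-≡ (u * a) _ _ (trans eq (cong (λ u′ → m + u′ * a) (+-identityʳ u))))
  ...   | suc t , refl = inj₂ (y , t , y<a , sym (+-cancelʳ-≡ (u * a) _ _ (begin
      y * b + u * a           ≡⟨ eq ⟩
      m + (u + suc t) * a     ≡⟨ ℕ-Ring.solve (m ∷ u ∷ t ∷ a ∷ []) ⟩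
      m + suc t * a + u * a   ∎)))
    where open ≡-Reasoning

  -- With w·b ≡ 1 (mod a), y = m·w mod a satisfies y·b ≡ m (mod a).
  rep⊎gap : ∀ m → Rep₂ a b m ⊎ Gap m
  rep⊎gap m with (w , K , wb≡1+Ka) ← coprime⇒invertible 1<a a⊥b =
    congruent⇒rep⊎gap {u = m * w / a * b} {v = m * K} (m%n<n (m * w) a) (begin
      (m * w) % a * b + m * w / a * b * a ≡⟨ regroup ((m * w) % a) (m * w / a) ⟩
      ((m * w) % a + m * w / a * a) * b   ≡⟨ cong (_* b) (m≡m%n+[m/n]*n (m * w) a) ⟨
      m * w * b                           ≡⟨ *-assoc m w b ⟩
      m * (w * b)                         ≡⟨ cong (m *_) wb≡1+Ka ⟩
      m * (1 + K * a)                     ≡⟨ ℕ-Ring.solve (m ∷ K ∷ a ∷ []) ⟩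
      m + m * K * a                       ∎)
    where
      open ≡-Reasoning
      regroup : ∀ r q → r * b + q * b * a ≡ (r + q * a) * b
      regroup r q = ℕ-Ring.solve (r ∷ q ∷ a ∷ b ∷ [])

  rep₂? : Decidable (Rep₂ a b)
  rep₂? m with rep⊎gap m
  ... | inj₁ rep = yes rep
  ... | inj₂ gap = no (gap⇒¬rep₂ gap)

  sylvester-number : a < b → ∃[ g ] g + a ≡ pred a * b
  sylvester-number a<b =
    pred a * b ∸ a ,
    m∸n+n≡m (≤-trans (<⇒≤ a<b) (m≤n*m b (pred a) {{>-nonZero (<⇒≤pred 1<a)}}))

  frobenius₂ : ∀ {g} → g + a ≡ pred a * b → IsFrobenius₂ a b g
  frobenius₂ {g} g+a≡ =
    gap⇒¬rep₂ (pred a , 0 , subst (pred a <_) (suc-pred a) (n<1+n (pred a)) ,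
               trans (cong (_+_ g) (+-identityʳ a)) g+a≡) ,
    above
    where
      above : ∀ m → g < m → Rep₂ a b m
      above m g<m with rep⊎gap m
      ... | inj₁ rep = rep
      ... | inj₂ (y , k , y<a , m+ka≡yb) = ⊥-elim (<-irrefl refl (begin-strict
        y * b         ≤⟨ *-monoˡ-≤ b (<⇒≤pred y<a) ⟩
        pred a * b    ≡⟨ g+a≡ ⟨
        g + a         <⟨ +-monoˡ-< a g<m ⟩
        m + a         ≤⟨ +-monoʳ-≤ m (m≤m+n a (k * a)) ⟩
        m + suc k * a ≡⟨ m+ka≡yb ⟩
        y * b         ∎))
        where open ≤-Reasoning

  gap⇒rep₃ : ∀ {c g} → g + a ≡ pred a * b → Gap c → Rep₃ a b c g
  gap⇒rep₃ {c} {g} g+a≡ (y , k , y<a , c+ka≡yb) with (e , y+e≡) ← m≤n⇒∃[o]m+o≡n (<⇒≤pred y<a) =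
    k , e , 1 , +-cancelʳ-≡ a _ _ (begin
      k * a + e * b + 1 * c + a ≡⟨ ℕ-Ring.solve (k ∷ a ∷ e ∷ b ∷ c ∷ []) ⟩
      (c + suc k * a) + e * b   ≡⟨ cong (_+ e * b) c+ka≡yb ⟩
      y * b + e * b             ≡⟨ *-distribʳ-+ b y e ⟨
      (y + e) * b               ≡⟨ cong (_* b) y+e≡ ⟩
      pred a * b                ≡⟨ g+a≡ ⟨
      g + a                     ∎)
    where open ≡-Reasoning

  frobenius₃<frobenius₂ : ∀ {c g₂} → 1 < b → 1 < c → IsFrobenius₂ a b g₂ → Rep₃ a b c g₂ →
                          ∃[ g₃ ] IsFrobenius₃ a b c g₃ × g₃ < g₂
  frobenius₃<frobenius₂ {c} {g₂} 1<b 1<c (¬rep₂-g₂ , above₂) rep₃-g₂ =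
    let g₃ , g₃≤g₂ , ¬rep₃-g₃ , above₃ =
          largest-failure (rep₃? (<-trans z<s 1<c) rep₂?) g₂ (¬rep₃-1 1<a 1<b 1<c) 1≤g₂
                          (λ m g₂<m → rep₂⇒rep₃ (above₂ m g₂<m))
    in g₃ , (¬rep₃-g₃ , above₃) ,
       ≤∧≢⇒< g₃≤g₂ (λ g₃≡g₂ → ¬rep₃-g₃ (subst (Rep₃ a b c) (sym g₃≡g₂) rep₃-g₂))
    where
      1≤g₂ : 1 ≤ g₂
      1≤g₂ = n≢0⇒n>0 (λ g₂≡0 → ¬rep₂-g₂ (0 , 0 , sym g₂≡0))

  gap⇒exceptional : ∀ {c} → a < b → b < c → Gap c → Exceptional a b c
  gap⇒exceptional {c} a<b b<c gap =
    let g₂ , g₂+a≡ = sylvester-number a<b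
        g₃ , frobenius-g₃ , g₃<g₂ =
          frobenius₃<frobenius₂ 1<b (<-trans 1<b b<c) (frobenius₂ g₂+a≡) (gap⇒rep₃ g₂+a≡ gap)
    in b<c , trans (cong (λ d → gcd d c) (coprime⇒gcd≡1 a⊥b)) (gcd-zeroˡ c) ,
       g₃ , g₂ , frobenius-g₃ , frobenius₂ g₂+a≡ , g₃<g₂
    where
      1<b : 1 < b
      1<b = <-trans 1<a a<b

  ¬rep₂⇒gap : ∀ {m} → ¬ Rep₂ a b m → Gap m
  ¬rep₂⇒gap {m} ¬rep with rep⊎gap m
  ... | inj₁ rep = contradiction rep ¬rep
  ... | inj₂ gap = gap

  ⌊_·b/a⌋ : ℕ → ℕ
  ⌊ j ·b/a⌋ = j * b / a

  ≤⌊·b/a⌋⇒*a≤ : ∀ j {k} → k ≤ ⌊ j ·b/a⌋ → k * a ≤ j * b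
  ≤⌊·b/a⌋⇒*a≤ j k≤ = ≤-trans (*-monoˡ-≤ a k≤) (m/n*n≤m (j * b) a)

  *a≤⇒≤⌊·b/a⌋ : ∀ j k → k * a ≤ j * b → k ≤ ⌊ j ·b/a⌋
  *a≤⇒≤⌊·b/a⌋ j k ka≤jb = subst (_≤ ⌊ j ·b/a⌋) (m*n/n≡m k a) (/-monoˡ-≤ a ka≤jb)

  ≤⌊·b/a⌋⇒*a< : ∀ j {k} → 0 < j → j < a → k ≤ ⌊ j ·b/a⌋ → k * a < j * b
  ≤⌊·b/a⌋⇒*a< j {k} 0<j j<a k≤ =
    ≤∧≢⇒< (≤⌊·b/a⌋⇒*a≤ j k≤) (λ ka≡jb → a∤j*b 0<j j<a (divides k (sym ka≡jb)))

  row : ℕ → List ℕ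
  row j = applyUpTo (λ k → suc j * b ∸ suc k * a) ⌊ j ·b/a⌋

  ∈-row⁻ : ∀ j {c} → 0 < j → j < a → c ∈ row j →
           ∃[ k ] suc k * a < j * b × c + suc k * a ≡ suc j * b
  ∈-row⁻ j 0<j j<a c∈row with ∈-applyUpTo⁻ (λ k → suc j * b ∸ suc k * a) c∈row
  ... | k , k<⌊⌋ , refl = k , ka<jb , m∸n+n≡m (≤-trans (<⇒≤ ka<jb) (m≤n+m (j * b) b))
    where
      ka<jb : suc k * a < j * b
      ka<jb = ≤⌊·b/a⌋⇒*a< j 0<j j<a k<⌊⌋

  ∈-row⁺ : ∀ j k {c} → suc k * a ≤ j * b → c + suc k * a ≡ suc j * b → c ∈ row j
  ∈-row⁺ j k {c} ka≤jb c+ka≡ =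
    subst (_∈ row j) (trans (cong (_∸ suc k * a) (sym c+ka≡)) (m+n∸n≡m c (suc k * a)))
          (∈-applyUpTo⁺ (λ k → suc j * b ∸ suc k * a) (*a≤⇒≤⌊·b/a⌋ j (suc k) ka≤jb))

  ∈-row⇒gap : ∀ j {c} → 0 < j → suc j < a → c ∈ row j → b < c × Gap c
  ∈-row⇒gap j {c} 0<j 1+j<a c∈row =
    let k , ka<jb , c+ka≡ = ∈-row⁻ j 0<j (<-trans (n<1+n j) 1+j<a) c∈row
    in +-cancelʳ-< (suc k * a) b c (begin-strict
         b + suc k * a <⟨ +-monoʳ-< b ka<jb ⟩
         b + j * b     ≡⟨ c+ka≡ ⟨
         c + suc k * a ∎) ,
       suc j , k , 1+j<a , c+ka≡
    where open ≤-Reasoning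

  gap⇒∈-row : ∀ {c} → b < c → Gap c → ∃[ j ] 0 < j × suc j < a × c ∈ row j
  gap⇒∈-row {c} b<c (zero , k , _ , c+ka≡0) =
    contradiction (subst (b <_) (m+n≡0⇒m≡0 c c+ka≡0) b<c) λ ()
  gap⇒∈-row {c} b<c (suc j , k , 1+j<a , c+ka≡) =
    j , *-cancelʳ-< b 0 j (≤-<-trans z≤n ka<jb) , 1+j<a , ∈-row⁺ j k (<⇒≤ ka<jb) c+ka≡
    where
      open ≤-Reasoning
      ka<jb : suc k * a < j * b
      ka<jb = +-cancelˡ-< b (suc k * a) (j * b) (begin-strict
        b + suc k * a <⟨ +-monoˡ-< (suc k * a) b<c ⟩
        c + suc k * a ≡⟨ c+ka≡ ⟩
        b + j * b     ∎)

  row-unique : ∀ j → Unique (row j)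
  row-unique j = applyUpTo⁺₁ _ ⌊ j ·b/a⌋ λ {k} {k′} k<k′ k′<⌊⌋ →
    >⇒≢ (∸-monoʳ-< (*-monoˡ-< a (s≤s k<k′)) (≤-trans (≤⌊·b/a⌋⇒*a≤ j k′<⌊⌋) (m≤n+m (j * b) b)))

  rows-disjoint : ∀ {i j} → 0 < i → i < j → suc j < a → Disjoint (row i) (row j)
  rows-disjoint {i} {j} 0<i i<j 1+j<a {c} (c∈rowᵢ , c∈rowⱼ) =
    let k  , _ , c+ka≡[1+i]b  = ∈-row⁻ i 0<i (<-trans i<j j<a) c∈rowᵢ
        k′ , _ , c+k′a≡[1+j]b = ∈-row⁻ j (<-trans 0<i i<j) j<a c∈rowⱼ
    in <⇒≢ (s≤s i<j) (gap-index-unique {c} {k = k} {k′} (<-trans (s≤s i<j) 1+j<a) 1+j<a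
                                        c+ka≡[1+i]b c+k′a≡[1+j]b)
    where
      j<a : j < a
      j<a = <-trans (n<1+n j) 1+j<a

  exceptional-list : a < b → ∃[ L ] Unique L × (∀ c → (c ∈ L) ⇔ Exceptional a b c) ×
                                    length L ≡ ∑ ⌊_·b/a⌋ (a ∸ 2)
  exceptional-list a<b =
    rows row (a ∸ 2) ,
    rows-unique row (a ∸ 2) (λ {j} _ _ → row-unique j)
                            (λ 0<i i<j j≤a∸2 → rows-disjoint 0<i i<j (≤a∸2⇒1+j<a j≤a∸2)) ,
    (λ c → mk⇔ ∈rows⇒exceptional exceptional⇒∈rows) ,
    trans (length-rows row (a ∸ 2)) (∑-cong (a ∸ 2) λ {j} _ _ → length-applyUpTo _ ⌊ j ·b/a⌋)
    where
      ≤a∸2⇒1+j<a : ∀ {j} → j ≤ a ∸ 2 → suc j < a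
      ≤a∸2⇒1+j<a j≤a∸2 = ≤-trans (+-monoʳ-≤ 2 j≤a∸2) (≤-reflexive (m+[n∸m]≡n 1<a))
      ∈rows⇒exceptional : ∀ {c} → c ∈ rows row (a ∸ 2) → Exceptional a b c
      ∈rows⇒exceptional c∈rows =
        let j , 0<j , j≤a∸2 , c∈row = ∈-rows⁻ row (a ∸ 2) c∈rows
            b<c , gap = ∈-row⇒gap j 0<j (≤a∸2⇒1+j<a j≤a∸2) c∈row
        in gap⇒exceptional a<b b<c gap
      exceptional⇒∈rows : ∀ {c} → Exceptional a b c → c ∈ rows row (a ∸ 2)
      exceptional⇒∈rows exceptional =
        let b<c , ¬rep = exceptional⇒¬rep₂ exceptional
            j , 0<j , 1+j<a , c∈row = gap⇒∈-row b<c (¬rep₂⇒gap ¬rep)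
        in ∈-rows⁺ row 0<j (∸-monoˡ-≤ 2 1+j<a) c∈row

  ⌊·b/a⌋-complement : ∀ {j} → 0 < j → j < a → suc (⌊ j ·b/a⌋ + ⌊ a ∸ j ·b/a⌋) ≡ b
  ⌊·b/a⌋-complement {j} 0<j j<a = /-complement (a∤j*b 0<j j<a) (begin
    j * b + (a ∸ j) * b ≡⟨ *-distribʳ-+ b j (a ∸ j) ⟨
    (j + (a ∸ j)) * b   ≡⟨ cong (_* b) (m+[n∸m]≡n (<⇒≤ j<a)) ⟩
    a * b               ≡⟨ *-comm a b ⟩
    b * a               ∎)
    where open ≡-Reasoning

  ∑⌊·b/a⌋-pairs : ∑ ⌊_·b/a⌋ (pred a) + ∑ ⌊_·b/a⌋ (pred a) ≡ pred a * pred b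
  ∑⌊·b/a⌋-pairs = ∑-pairs ⌊_·b/a⌋ (pred a) λ {j} 0<j j≤pred[a] → begin
    ⌊ j ·b/a⌋ + ⌊ suc (pred a) ∸ j ·b/a⌋ ≡⟨ cong (λ a′ → ⌊ j ·b/a⌋ + ⌊ a′ ∸ j ·b/a⌋) (suc-pred a) ⟩
    ⌊ j ·b/a⌋ + ⌊ a ∸ j ·b/a⌋
      ≡⟨ cong pred (⌊·b/a⌋-complement 0<j (subst (j <_) (suc-pred a) (s≤s j≤pred[a]))) ⟩
    pred b                              ∎
    where open ≡-Reasoning

  b/a+⌊[a∸1]·b/a⌋≡pred[b] : b / a + ⌊ a ∸ 1 ·b/a⌋ ≡ pred b
  b/a+⌊[a∸1]·b/a⌋≡pred[b] = cong pred (begin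
    suc (b / a + ⌊ a ∸ 1 ·b/a⌋)     ≡⟨ cong (λ b′ → suc (b′ / a + ⌊ a ∸ 1 ·b/a⌋)) (*-identityˡ b) ⟨
    suc (⌊ 1 ·b/a⌋ + ⌊ a ∸ 1 ·b/a⌋) ≡⟨ ⌊·b/a⌋-complement z<s 1<a ⟩
    b                               ∎)
    where open ≡-Reasoning

theorem4 : (a b : ℕ) .{{_ : NonZero a}} → Coprime a b → 2 ≤ a → a < b →
    ∃[ L ] (Unique L × (∀ c → (c ∈ L) ⇔ Exceptional a b c) ×
      + (length L) ≡ ((+ a ℤ.- + 3) ℤ.* (+ b ℤ.- + 1)) /ℕ 2 ℤ.+ + (b / a))
theorem4 _ _ a⊥b 1<a@(s≤s (s≤s {n = n} z≤n)) a<b@(s≤s {n = b′} _) =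
  let L , unique , ∈L⇔exceptional , |L|≡S = exceptional-list a<b in
  L , unique , ∈L⇔exceptional ,
  trans (cong +_ |L|≡S) (closed-form (+ n) (+ b′) (+ S) (+ F) (+ q) 2[S+F]≡[1+n]b′ q+F≡b′)
  where
    open TwoGenerators (2 + n) (suc b′) a⊥b 1<a
    S F q : ℕ
    S = ∑ ⌊_·b/a⌋ n
    F = ⌊ suc n ·b/a⌋
    q = suc b′ / (2 + n)
    2[S+F]≡[1+n]b′ : (+ S ℤ.+ + F) ℤ.+ (+ S ℤ.+ + F) ≡ (+ 1 ℤ.+ + n) ℤ.* + b′
    2[S+F]≡[1+n]b′ = trans (cong +_ ∑⌊·b/a⌋-pairs) (pos-* (suc n) b′)
    q+F≡b′ : + q ℤ.+ + F ≡ + b′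
    q+F≡b′ = cong +_ b/a+⌊[a∸1]·b/a⌋≡pred[b]
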